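{- Let $m,k\in\mathbb N_0$. In each sum below, the index $i$ runs only over values with $m+i$ even. (1) If $0\leq k\leq m$, then $$\sum_{\substack{i=0\\ m+i~\text{even}}}^{m}\binom mi\binom{m+i}{k}\binom{m+i-k}{m-k}E_i(0)=(-1)^m\binom{m}{k}.$$ (2) If $0\leq k\leq m-1$, then $$\sum_{\substack{i=0\\ m+i~\text{even}}}^{m}\binom mi\binom{m+i}{k}\binom{m+i-k}{m-k-1}E_{i+1}(0)=0.$$ (3) If $l\in\mathbb N_0$ with $0\leq l\leq m-k-1$, then $$\sum_{\substack{i=0\\ m+i~\text{even}}}^{m}\binom mi\binom{m+i}{k}\binom{m+i-k}{l}E_{m+i-k-l}(0)=0.$$ (4) If $1\leq j\leq m$ and $0\leq k\leq m$, then $$\sum_{\substack{i=j\\ m+i~\text{even}}}^{m}\binom mi\binom{m+i}{k}\binom{m+i-k}{m+j-k}E_{i-j}(0)=(-1)^{m+j}\binom mj\binom{m+j}{k}.$$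
   Context: The Euler polynomials $E_n(a)$ are defined by $\frac{2e^{at}}{e^t+1}=\sum_{n=0}^\infty E_n(a)\frac{t^n}{n!}$; $\binom{N}{k}$ denotes the binomial coefficient. -}

module Defs where

open import Data.Nat as ℕ using (ℕ; zero; suc; _∸_; _%_; _≡ᵇ_)
open import Data.Nat.Combinatorics using (_C_)
open import Data.Integer using (+_)
open import Data.Rational using (ℚ; _/_; _+_; _*_; _-_; -_; 0ℚ; 1ℚ; ½)
open import Data.Fin using (Fin; toℕ; fromℕ)
open import Data.Vec using (Vec; []; _∷ʳ_; lookup; tabulate; zipWith; foldr)
open import Data.List as List using (List; map; applyUpTo)
open import Data.Bool using (Bool; if_then_else_)

ℕ→ℚ : ℕ → ℚ
ℕ→ℚ n = + n / 1

_^ℚ_ : ℚ → ℕ → ℚ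
x ^ℚ zero  = 1ℚ
x ^ℚ suc n = x * (x ^ℚ n)

sign : ℕ → ℚ
sign zero    = 1ℚ
sign (suc n) = - sign n

sumVec : ∀ {n} → Vec ℚ n → ℚ
sumVec = foldr _ _+_ 0ℚ

-- Euler polynomials E_n(x), defined by 2e^{xt}/(e^t+1) = Σ E_n(x) t^n/n!.
-- Comparing coefficients of t^n in 2e^{xt} = (e^t+1) Σ E_n(x) t^n/n! gives
--   2 x^n = E_n(x) + Σ_{k=0}^{n} C(n,k) E_k(x),
-- i.e. E_n(x) = x^n - ½ Σ_{k<n} C(n,k) E_k(x), which determines them uniquely.
-- EulerVec n x = [E_0(x), …, E_{n-1}(x)]
EulerVec : (n : ℕ) → ℚ → Vec ℚ n
EulerVec zero    x = []
EulerVec (suc n) x =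
  EulerVec n x ∷ʳ ((x ^ℚ n) - ½ * sumVec (zipWith _*_ (tabulate (λ k → ℕ→ℚ (n C toℕ k))) (EulerVec n x)))

EulerPoly : ℕ → ℚ → ℚ
EulerPoly n x = lookup (EulerVec (suc n) x) (fromℕ n)

-- Σ_{i=a}^{b} f i   (empty if b < a)
sumFromTo : ℕ → ℕ → (ℕ → ℚ) → ℚ
sumFromTo a b f = List.foldr _+_ 0ℚ (map f (applyUpTo (ℕ._+_ a) (suc b ∸ a)))

isEven : ℕ → Bool
isEven n = n % 2 ≡ᵇ 0

sumParity : ℕ → ℕ → ℕ → (ℕ → ℚ) → ℚ
sumParity m a b f = sumFromTo a b (λ i → if isEven (m ℕ.+ i) then f i else 0ℚ)

-- Let P be the Pascal matrix P p n = C(p,n) and Ê the matrix Ê n t = C(n,t) E_{n-t}(0).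
-- The recurrence Σ_k C(n,k) E_k(0) + E_n(0) = 2·0ⁿ, i.e. (eˣ + 1)·2/(eˣ + 1) = 2 on
-- exponential generating functions, says that (P + I) Ê = 2I. The finite-difference
-- identity Σ_q (-1)^q C(m,q) C(a+q,n) = (-1)^m C(a,n-m) shows that the row vector
-- ρ p = (-1)^p C(m,p-m) satisfies (ρ P) n = C(m,n-m), so ρ (P + I) has entries
-- (1 + (-1)^n) C(m,n-m): twice C(m,i) at n = m + i when m + i is even, and 0 otherwise.
-- Multiplying by Ê therefore gives, for t ≤ 2m,
--   Σ_{i ≤ m, m+i even} C(m,i) C(m+i,t) E_{m+i-t}(0) = ρ t = (-1)^t C(m,t-m).
-- After C(m+i,k) C(m+i-k,t-k) = C(m+i,t) C(t,k), identities (1)-(4) are this at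
-- t = m, m-1, l+k and m+j respectively.

module Submission where

open import Data.Empty using (⊥-elim)
open import Data.Bool using (true; false; if_then_else_)
open import Data.Fin as Fin using (Fin; toℕ; fromℕ)
open import Data.Integer as ℤ using (1ℤ) renaming (+_ to +ℤ_)
import Data.Integer.Properties as ℤ
import Data.List as List
open import Data.Nat as ℕ using (ℕ; zero; suc; _∸_; _≤_; _<_; z≤n; s≤s; _!)
open import Data.Nat.Combinatorics
  using (_C_; nCn≡1; k>n⇒nCk≡0; nCk+nC[k+1]≡[n+1]C[k+1]; nCk≡n!/k![n-k]!; k![n∸k]!∣n!)
open import Data.Nat.DivMod using (m/n*n≡m)
open import Data.Nat.Divisibility using (∣1⇒≡1)
import Data.Nat.Properties as ℕ
import Data.Nat.Tactic.RingSolver as ℕ-Solver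
open import Data.Product using (_×_; _,_)
open import Data.Rational using (ℚ; toℚᵘ; _+_; _*_; -_; _-_; 0ℚ; 1ℚ; ½)
open import Data.Rational.Properties
import Data.Rational.Unnormalised as ℚᵘ
import Data.Rational.Unnormalised.Properties as ℚᵘ
open import Data.Vec using (Vec; []; _∷_; _∷ʳ_; lookup; tabulate; zipWith)
open import Function using (_∘_; case_of_)
open import Relation.Binary.Definitions using (tri<; tri≈; tri>)
open import Relation.Binary.PropositionalEquality
open import Relation.Nullary using (yes; no)
open import Relation.Nullary.Decidable using (dec⇒maybe)
open import Tactic.RingSolver using (solve-∀)
open import Tactic.RingSolver.Core.AlmostCommutativeRing using (AlmostCommutativeRing; fromCommutativeRing)

open import Defs

ℚ-ring : AlmostCommutativeRing _ _
ℚ-ring = fromCommutativeRing +-*-commutativeRing (λ x → dec⇒maybe (0ℚ ≟ x))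

2ℚ : ℚ
2ℚ = 1ℚ + 1ℚ

toℚᵘ-ℕ→ℚ : ∀ n → toℚᵘ (ℕ→ℚ n) ≡ ℚᵘ.mkℚᵘ (+ℤ n) 0
toℚᵘ-ℕ→ℚ n = cong toℚᵘ (normalize-coprime λ (_ , i∣1) → ∣1⇒≡1 i∣1)

ℕ→ℚ-homo-+ : ∀ m n → ℕ→ℚ (m ℕ.+ n) ≡ ℕ→ℚ m + ℕ→ℚ n
ℕ→ℚ-homo-+ m n = toℚᵘ-injective (begin
  toℚᵘ (ℕ→ℚ (m ℕ.+ n))                     ≡⟨ toℚᵘ-ℕ→ℚ (m ℕ.+ n) ⟩
  ℚᵘ.mkℚᵘ (+ℤ (m ℕ.+ n)) 0                 ≈⟨ ℚᵘ.*≡* pos-+-over-1 ⟩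
  ℚᵘ.mkℚᵘ (+ℤ m) 0 ℚᵘ.+ ℚᵘ.mkℚᵘ (+ℤ n) 0   ≡⟨ sym (cong₂ ℚᵘ._+_ (toℚᵘ-ℕ→ℚ m) (toℚᵘ-ℕ→ℚ n)) ⟩
  toℚᵘ (ℕ→ℚ m) ℚᵘ.+ toℚᵘ (ℕ→ℚ n)           ≈⟨ ℚᵘ.≃-sym (toℚᵘ-homo-+ (ℕ→ℚ m) (ℕ→ℚ n)) ⟩
  toℚᵘ (ℕ→ℚ m + ℕ→ℚ n)                     ∎)
  where
  open ℚᵘ.≃-Reasoning
  pos-+-over-1 : +ℤ (m ℕ.+ n) ℤ.* 1ℤ ≡ (+ℤ m ℤ.* 1ℤ ℤ.+ +ℤ n ℤ.* 1ℤ) ℤ.* 1ℤ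
  pos-+-over-1 rewrite ℤ.*-identityʳ (+ℤ m) | ℤ.*-identityʳ (+ℤ n) = cong (ℤ._* 1ℤ) (ℤ.pos-+ m n)

ℕ→ℚ-homo-* : ∀ m n → ℕ→ℚ (m ℕ.* n) ≡ ℕ→ℚ m * ℕ→ℚ n
ℕ→ℚ-homo-* m n = toℚᵘ-injective (begin
  toℚᵘ (ℕ→ℚ (m ℕ.* n))                     ≡⟨ toℚᵘ-ℕ→ℚ (m ℕ.* n) ⟩
  ℚᵘ.mkℚᵘ (+ℤ (m ℕ.* n)) 0                 ≈⟨ ℚᵘ.*≡* (cong (ℤ._* 1ℤ) (ℤ.pos-* m n)) ⟩
  ℚᵘ.mkℚᵘ (+ℤ m) 0 ℚᵘ.* ℚᵘ.mkℚᵘ (+ℤ n) 0   ≡⟨ sym (cong₂ ℚᵘ._*_ (toℚᵘ-ℕ→ℚ m) (toℚᵘ-ℕ→ℚ n)) ⟩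
  toℚᵘ (ℕ→ℚ m) ℚᵘ.* toℚᵘ (ℕ→ℚ n)           ≈⟨ ℚᵘ.≃-sym (toℚᵘ-homo-* (ℕ→ℚ m) (ℕ→ℚ n)) ⟩
  toℚᵘ (ℕ→ℚ m * ℕ→ℚ n)                     ∎)
  where open ℚᵘ.≃-Reasoning

∑ : ℕ → (ℕ → ℚ) → ℚ
∑ zero    f = 0ℚ
∑ (suc n) f = f 0 + ∑ n (f ∘ suc)

syntax ∑ n (λ i → x) = ∑[ i < n ] x

∑-cong : ∀ n {f g : ℕ → ℚ} → (∀ i → i < n → f i ≡ g i) → ∑ n f ≡ ∑ n g
∑-cong zero    f≡g = refl
∑-cong (suc n) f≡g = cong₂ _+_ (f≡g 0 (s≤s z≤n)) (∑-cong n λ i i<n → f≡g (suc i) (s≤s i<n))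

∑-zero : ∀ n {f : ℕ → ℚ} → (∀ i → i < n → f i ≡ 0ℚ) → ∑ n f ≡ 0ℚ
∑-zero n {f} f≡0 = trans (∑-cong n f≡0) (∑-const-0 n)
  where
  ∑-const-0 : ∀ n → ∑[ i < n ] 0ℚ ≡ 0ℚ
  ∑-const-0 zero    = refl
  ∑-const-0 (suc n) = cong (0ℚ +_) (∑-const-0 n)

∑-+ : ∀ n (f g : ℕ → ℚ) → ∑[ i < n ] (f i + g i) ≡ ∑ n f + ∑ n g
∑-+ zero    f g = refl
∑-+ (suc n) f g = trans (cong (f 0 + g 0 +_) (∑-+ n (f ∘ suc) (g ∘ suc)))
                        (+-interchange (f 0) (g 0) (∑ n (f ∘ suc)) (∑ n (g ∘ suc)))
  where
  +-interchange : ∀ a b c d → (a + b) + (c + d) ≡ (a + c) + (b + d)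
  +-interchange = solve-∀ ℚ-ring

∑-*ˡ : ∀ n c (f : ℕ → ℚ) → ∑[ i < n ] (c * f i) ≡ c * ∑ n f
∑-*ˡ zero    c f = sym (*-zeroʳ c)
∑-*ˡ (suc n) c f = trans (cong (c * f 0 +_) (∑-*ˡ n c (f ∘ suc))) (sym (*-distribˡ-+ c (f 0) _))

∑-*ʳ : ∀ n c (f : ℕ → ℚ) → ∑[ i < n ] (f i * c) ≡ ∑ n f * c
∑-*ʳ n c f = trans (∑-cong n λ i _ → *-comm (f i) c) (trans (∑-*ˡ n c f) (*-comm c (∑ n f)))

∑-split : ∀ m n (f : ℕ → ℚ) → ∑ (m ℕ.+ n) f ≡ ∑ m f + ∑[ i < n ] f (m ℕ.+ i)
∑-split zero    n f = sym (+-identityˡ _)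
∑-split (suc m) n f = trans (cong (f 0 +_) (∑-split m n (f ∘ suc))) (sym (+-assoc (f 0) _ _))

∑-last : ∀ n (f : ℕ → ℚ) → ∑ (suc n) f ≡ ∑ n f + f n
∑-last zero    f = +-comm (f 0) 0ℚ
∑-last (suc n) f = trans (cong (f 0 +_) (∑-last n (f ∘ suc))) (sym (+-assoc (f 0) _ _))

∑-swap : ∀ m n (f : ℕ → ℕ → ℚ) → ∑[ i < m ] ∑[ j < n ] f i j ≡ ∑[ j < n ] ∑[ i < m ] f i j
∑-swap zero    n f = sym (∑-zero n λ _ _ → refl)
∑-swap (suc m) n f = trans (cong (∑ n (f 0) +_) (∑-swap m n (f ∘ suc)))
                           (sym (∑-+ n (f 0) λ j → ∑[ i < m ] f (suc i) j))

∑-skip : ∀ m n {f : ℕ → ℚ} → (∀ i → i < m → f i ≡ 0ℚ) →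
         ∑ (m ℕ.+ n) f ≡ ∑[ i < n ] f (m ℕ.+ i)
∑-skip m n {f} f≡0 = begin
  ∑ (m ℕ.+ n) f                   ≡⟨ ∑-split m n f ⟩
  ∑ m f + ∑[ i < n ] f (m ℕ.+ i)  ≡⟨ cong (_+ ∑[ i < n ] f (m ℕ.+ i)) (∑-zero m f≡0) ⟩
  0ℚ + ∑[ i < n ] f (m ℕ.+ i)     ≡⟨ +-identityˡ _ ⟩
  ∑[ i < n ] f (m ℕ.+ i)          ∎
  where open ≡-Reasoning

∑-truncate : ∀ {m n} {f : ℕ → ℚ} → m ≤ n → (∀ i → m ≤ i → f i ≡ 0ℚ) → ∑ n f ≡ ∑ m f
∑-truncate {m} {n} {f} m≤n f≡0 = begin
  ∑ n f                               ≡⟨ cong (λ k → ∑ k f) (sym (ℕ.m+[n∸m]≡n m≤n)) ⟩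
  ∑ (m ℕ.+ (n ∸ m)) f                 ≡⟨ ∑-split m (n ∸ m) f ⟩
  ∑ m f + ∑[ i < n ∸ m ] f (m ℕ.+ i)  ≡⟨ cong (∑ m f +_) (∑-zero (n ∸ m) λ i _ → f≡0 (m ℕ.+ i) (ℕ.m≤m+n m i)) ⟩
  ∑ m f + 0ℚ                          ≡⟨ +-identityʳ _ ⟩
  ∑ m f                               ∎
  where open ≡-Reasoning

∑-single : ∀ {n t} {f : ℕ → ℚ} → t < n → (∀ i → i < n → i ≢ t → f i ≡ 0ℚ) → ∑ n f ≡ f t
∑-single {suc n} {zero}  {f} _         f≡0 =
  trans (cong (f 0 +_) (∑-zero n λ i i<n → f≡0 (suc i) (s≤s i<n) λ ())) (+-identityʳ (f 0))
∑-single {suc n} {suc t} {f} (s≤s t<n) f≡0 =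
  trans (cong (_+ ∑ n (f ∘ suc)) (f≡0 0 (s≤s z≤n) λ ()))
        (trans (+-identityˡ _) (∑-single t<n λ i i<n i≢t → f≡0 (suc i) (s≤s i<n) (i≢t ∘ ℕ.suc-injective)))

sumFromTo≡∑ : ∀ a b (f : ℕ → ℚ) → sumFromTo a b f ≡ ∑[ i < suc b ∸ a ] f (a ℕ.+ i)
sumFromTo≡∑ a b f = foldr-applyUpTo (a ℕ.+_) (suc b ∸ a)
  where
  foldr-applyUpTo : ∀ g n → List.foldr _+_ 0ℚ (List.map f (List.applyUpTo g n)) ≡ ∑[ i < n ] f (g i)
  foldr-applyUpTo g zero    = refl
  foldr-applyUpTo g (suc n) = cong (f (g 0) +_) (foldr-applyUpTo (g ∘ suc) n)

sumFromTo-skip : ∀ {a b} {f : ℕ → ℚ} → a ≤ suc b → (∀ i → i < a → f i ≡ 0ℚ) →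
                 sumFromTo a b f ≡ sumFromTo 0 b f
sumFromTo-skip {a} {b} {f} a≤1+b f≡0 = begin
  sumFromTo a b f                    ≡⟨ sumFromTo≡∑ a b f ⟩
  ∑[ i < suc b ∸ a ] f (a ℕ.+ i)     ≡⟨ sym (∑-skip a (suc b ∸ a) f≡0) ⟩
  ∑ (a ℕ.+ (suc b ∸ a)) f            ≡⟨ cong (λ n → ∑ n f) (ℕ.m+[n∸m]≡n a≤1+b) ⟩
  ∑ (suc b) f                        ≡⟨ sym (sumFromTo≡∑ 0 b f) ⟩
  sumFromTo 0 b f                    ∎
  where open ≡-Reasoning

sumParity-scale : ∀ m a b c {f g : ℕ → ℚ} → (∀ i → f i ≡ c * g i) →
                  sumParity m a b f ≡ c * sumParity m a b g
sumParity-scale m a b c {f} {g} f≡cg = begin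
  sumParity m a b f                                      ≡⟨ sumFromTo≡∑ a b _ ⟩
  ∑[ i < suc b ∸ a ] parity f (a ℕ.+ i)                  ≡⟨ ∑-cong (suc b ∸ a) (λ i _ → parity-scale (a ℕ.+ i)) ⟩
  ∑[ i < suc b ∸ a ] (c * parity g (a ℕ.+ i))            ≡⟨ ∑-*ˡ (suc b ∸ a) c _ ⟩
  c * ∑[ i < suc b ∸ a ] parity g (a ℕ.+ i)              ≡⟨ cong (c *_) (sym (sumFromTo≡∑ a b _)) ⟩
  c * sumParity m a b g                                  ∎
  where
  open ≡-Reasoning
  parity : (ℕ → ℚ) → ℕ → ℚ
  parity h i = if isEven (m ℕ.+ i) then h i else 0ℚ
  parity-scale : ∀ i → parity f i ≡ c * parity g i
  parity-scale i with isEven (m ℕ.+ i)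
  ... | true  = f≡cg i
  ... | false = sym (*-zeroʳ c)

nCk*[k!*[n∸k]!]≡n! : ∀ {n k} → k ≤ n → (n C k) ℕ.* (k ! ℕ.* (n ∸ k) !) ≡ n !
nCk*[k!*[n∸k]!]≡n! {n} {k} k≤n =
  trans (cong (ℕ._* (k ! ℕ.* (n ∸ k) !)) (nCk≡n!/k![n-k]! k≤n))
        (m/n*n≡m {{k ℕ.!* (n ∸ k) !≢0}} (k![n∸k]!∣n! k≤n))

nCr*rCk≡nCk*[n∸k]C[r∸k] : ∀ n {r k} → k ≤ r → (n C r) ℕ.* (r C k) ≡ (n C k) ℕ.* ((n ∸ k) C (r ∸ k))
nCr*rCk≡nCk*[n∸k]C[r∸k] n {r} {k} k≤r with r ℕ.≤? n
... | no r≰n = trans (cong (ℕ._* (r C k)) (k>n⇒nCk≡0 (ℕ.≰⇒> r≰n))) (sym rhs≡0)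
  where
  rhs≡0 : (n C k) ℕ.* ((n ∸ k) C (r ∸ k)) ≡ 0
  rhs≡0 with k ℕ.≤? n
  ... | no k≰n  = cong (ℕ._* ((n ∸ k) C (r ∸ k))) (k>n⇒nCk≡0 (ℕ.≰⇒> k≰n))
  ... | yes k≤n = trans (cong ((n C k) ℕ.*_) (k>n⇒nCk≡0 (ℕ.∸-monoˡ-< (ℕ.≰⇒> r≰n) k≤n))) (ℕ.*-zeroʳ (n C k))
... | yes r≤n = ℕ.*-cancelʳ-≡ _ _ (a ℕ.* b ℕ.* c) {{nonZero}} (trans lhs≡n! (sym rhs≡n!))
  where
  open ≡-Reasoning
  a = k !
  b = (r ∸ k) !
  c = (n ∸ r) !
  nonZero : ℕ.NonZero (a ℕ.* b ℕ.* c)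
  nonZero = ℕ.m*n≢0 _ _ {{k ℕ.!* (r ∸ k) !≢0}} {{(n ∸ r) ℕ.!≢0}}
  [n∸k]∸[r∸k]≡n∸r : (n ∸ k) ∸ (r ∸ k) ≡ n ∸ r
  [n∸k]∸[r∸k]≡n∸r = trans (ℕ.∸-+-assoc n k (r ∸ k)) (cong (n ∸_) (ℕ.m+[n∸m]≡n k≤r))
  regroupˡ : ∀ x y a b c → x ℕ.* y ℕ.* (a ℕ.* b ℕ.* c) ≡ x ℕ.* (y ℕ.* (a ℕ.* b)) ℕ.* c
  regroupˡ = ℕ-Solver.solve-∀
  regroupʳ : ∀ x y a b c → x ℕ.* y ℕ.* (a ℕ.* b ℕ.* c) ≡ x ℕ.* (a ℕ.* (y ℕ.* (b ℕ.* c)))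
  regroupʳ = ℕ-Solver.solve-∀
  lhs≡n! : (n C r) ℕ.* (r C k) ℕ.* (a ℕ.* b ℕ.* c) ≡ n !
  lhs≡n! = begin
    (n C r) ℕ.* (r C k) ℕ.* (a ℕ.* b ℕ.* c)    ≡⟨ regroupˡ (n C r) (r C k) a b c ⟩
    (n C r) ℕ.* ((r C k) ℕ.* (a ℕ.* b)) ℕ.* c  ≡⟨ cong (λ w → (n C r) ℕ.* w ℕ.* c) (nCk*[k!*[n∸k]!]≡n! k≤r) ⟩
    (n C r) ℕ.* r ! ℕ.* c                      ≡⟨ ℕ.*-assoc (n C r) (r !) c ⟩
    (n C r) ℕ.* (r ! ℕ.* c)                    ≡⟨ nCk*[k!*[n∸k]!]≡n! r≤n ⟩
    n !                                        ∎
  rhs≡n! : (n C k) ℕ.* ((n ∸ k) C (r ∸ k)) ℕ.* (a ℕ.* b ℕ.* c) ≡ n !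
  rhs≡n! = begin
    (n C k) ℕ.* ((n ∸ k) C (r ∸ k)) ℕ.* (a ℕ.* b ℕ.* c)
      ≡⟨ regroupʳ (n C k) ((n ∸ k) C (r ∸ k)) a b c ⟩
    (n C k) ℕ.* (a ℕ.* (((n ∸ k) C (r ∸ k)) ℕ.* (b ℕ.* c)))
      ≡⟨ cong (λ w → (n C k) ℕ.* (a ℕ.* (((n ∸ k) C (r ∸ k)) ℕ.* (b ℕ.* w !)))) (sym [n∸k]∸[r∸k]≡n∸r) ⟩
    (n C k) ℕ.* (a ℕ.* (((n ∸ k) C (r ∸ k)) ℕ.* (b ℕ.* ((n ∸ k) ∸ (r ∸ k)) !)))
      ≡⟨ cong (λ w → (n C k) ℕ.* (a ℕ.* w)) (nCk*[k!*[n∸k]!]≡n! (ℕ.∸-monoˡ-≤ k r≤n)) ⟩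
    (n C k) ℕ.* (a ℕ.* (n ∸ k) !)
      ≡⟨ nCk*[k!*[n∸k]!]≡n! (ℕ.≤-trans k≤r r≤n) ⟩
    n !  ∎

infix 8 _Cℚ_

_Cℚ_ : ℕ → ℕ → ℚ
n Cℚ k = ℕ→ℚ (n C k)

k>n⇒nCℚk≡0 : ∀ {n k} → n < k → n Cℚ k ≡ 0ℚ
k>n⇒nCℚk≡0 n<k = cong ℕ→ℚ (k>n⇒nCk≡0 n<k)

nCℚr*rCℚk≡nCℚk*[n∸k]Cℚ[r∸k] : ∀ n {r k} → k ≤ r → n Cℚ r * r Cℚ k ≡ n Cℚ k * (n ∸ k) Cℚ (r ∸ k)
nCℚr*rCℚk≡nCℚk*[n∸k]Cℚ[r∸k] n {r} {k} k≤r = begin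
  n Cℚ r * r Cℚ k                        ≡⟨ sym (ℕ→ℚ-homo-* (n C r) (r C k)) ⟩
  ℕ→ℚ ((n C r) ℕ.* (r C k))              ≡⟨ cong ℕ→ℚ (nCr*rCk≡nCk*[n∸k]C[r∸k] n k≤r) ⟩
  ℕ→ℚ ((n C k) ℕ.* ((n ∸ k) C (r ∸ k)))  ≡⟨ ℕ→ℚ-homo-* (n C k) ((n ∸ k) C (r ∸ k)) ⟩
  n Cℚ k * (n ∸ k) Cℚ (r ∸ k)            ∎
  where open ≡-Reasoning

-- The Euler recurrence

lookup-∷ʳ-fromℕ : ∀ {n} (xs : Vec ℚ n) y → lookup (xs ∷ʳ y) (fromℕ n) ≡ y
lookup-∷ʳ-fromℕ []       y = refl
lookup-∷ʳ-fromℕ (x ∷ xs) y = lookup-∷ʳ-fromℕ xs y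

lookup-∷ʳ-tabulated : ∀ {n} (g : ℕ → ℚ) (xs : Vec ℚ n) {y} → (∀ i → lookup xs i ≡ g (toℕ i)) →
                      y ≡ g n → ∀ i → lookup (xs ∷ʳ y) i ≡ g (toℕ i)
lookup-∷ʳ-tabulated g []       xs≡g y≡g Fin.zero    = y≡g
lookup-∷ʳ-tabulated g (x ∷ xs) xs≡g y≡g Fin.zero    = xs≡g Fin.zero
lookup-∷ʳ-tabulated g (x ∷ xs) xs≡g y≡g (Fin.suc i) = lookup-∷ʳ-tabulated (g ∘ suc) xs (xs≡g ∘ Fin.suc) y≡g i

lookup-EulerVec : ∀ n x (i : Fin n) → lookup (EulerVec n x) i ≡ EulerPoly (toℕ i) x
lookup-EulerVec (suc n) x = lookup-∷ʳ-tabulated (λ k → EulerPoly k x) (EulerVec n x) (lookup-EulerVec n x)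
                                                (sym (lookup-∷ʳ-fromℕ (EulerVec n x) _))

sumVec-zipWith-tabulate : ∀ {n} (c h : ℕ → ℚ) (w : Vec ℚ n) → (∀ i → lookup w i ≡ h (toℕ i)) →
                          sumVec (zipWith _*_ (tabulate (c ∘ toℕ)) w) ≡ ∑[ k < n ] (c k * h k)
sumVec-zipWith-tabulate c h []       w≡h = refl
sumVec-zipWith-tabulate c h (x ∷ xs) w≡h =
  cong₂ (λ y s → c 0 * y + s) (w≡h Fin.zero)
        (sumVec-zipWith-tabulate (c ∘ suc) (h ∘ suc) xs (w≡h ∘ Fin.suc))

EulerPoly-unfold : ∀ n x → EulerPoly n x ≡ x ^ℚ n - ½ * ∑[ k < n ] (n Cℚ k * EulerPoly k x)
EulerPoly-unfold n x = trans (lookup-∷ʳ-fromℕ (EulerVec n x) _)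
  (cong (λ s → x ^ℚ n - ½ * s)
        (sumVec-zipWith-tabulate (n Cℚ_) (λ k → EulerPoly k x) (EulerVec n x) (lookup-EulerVec n x)))

EulerPoly-recurrence : ∀ n x → ∑[ k < suc n ] (n Cℚ k * EulerPoly k x) + EulerPoly n x ≡ 2ℚ * x ^ℚ n
EulerPoly-recurrence n x = begin
  ∑[ k < suc n ] (n Cℚ k * E k) + E n     ≡⟨ cong (_+ E n) (∑-last n λ k → n Cℚ k * E k) ⟩
  (S + n Cℚ n * E n) + E n                ≡⟨ cong (λ c → (S + ℕ→ℚ c * E n) + E n) (nCn≡1 n) ⟩
  (S + 1ℚ * E n) + E n                    ≡⟨ cong (λ y → (S + 1ℚ * y) + y) (EulerPoly-unfold n x) ⟩
  (S + 1ℚ * (xⁿ - ½ * S)) + (xⁿ - ½ * S)  ≡⟨ halves-cancel S xⁿ ⟩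
  2ℚ * xⁿ                                 ∎
  where
  open ≡-Reasoning
  E : ℕ → ℚ
  E k = EulerPoly k x
  S = ∑[ k < n ] (n Cℚ k * E k)
  xⁿ = x ^ℚ n
  halves-cancel : ∀ s y → (s + 1ℚ * (y - ½ * s)) + (y - ½ * s) ≡ 2ℚ * y
  halves-cancel = solve-∀ ℚ-ring

-- The identity (P + I) Ê = 2I

E0 : ℕ → ℚ
E0 n = EulerPoly n 0ℚ

eulerMatrix : ℕ → ℕ → ℚ
eulerMatrix n t = n Cℚ t * E0 (n ∸ t)

eulerMatrix-upper : ∀ {n t} → n < t → eulerMatrix n t ≡ 0ℚ
eulerMatrix-upper {n} {t} n<t = trans (cong (_* E0 (n ∸ t)) (k>n⇒nCℚk≡0 n<t)) (*-zeroˡ (E0 (n ∸ t)))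

[P+I]Ê : ℕ → ℕ → ℕ → ℚ
[P+I]Ê N p t = ∑[ n < N ] (p Cℚ n * eulerMatrix n t) + eulerMatrix p t

[P+I]Ê-truncate : ∀ {N p} t → p < N → [P+I]Ê N p t ≡ [P+I]Ê (suc p) p t
[P+I]Ê-truncate {N} {p} t p<N = cong (_+ eulerMatrix p t) (∑-truncate p<N λ n p<n →
  trans (cong (_* eulerMatrix n t) (k>n⇒nCℚk≡0 p<n)) (*-zeroˡ (eulerMatrix n t)))

[P+I]Ê-column : ∀ t d → [P+I]Ê (suc (t ℕ.+ d)) (t ℕ.+ d) t ≡ (t ℕ.+ d) Cℚ t * (2ℚ * 0ℚ ^ℚ d)
[P+I]Ê-column t d = begin
  ∑ (suc p) entry + eulerMatrix p t
    ≡⟨ cong₂ _+_ (trans (cong (λ k → ∑ k entry) (sym (ℕ.+-suc t d))) (∑-skip t (suc d) λ n n<t → trans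
                   (cong (p Cℚ n *_) (eulerMatrix-upper n<t)) (*-zeroʳ (p Cℚ n))))
                 (cong (λ k → p Cℚ t * E0 k) (ℕ.m+n∸m≡n t d)) ⟩
  ∑[ u < suc d ] entry (t ℕ.+ u) + p Cℚ t * E0 d
    ≡⟨ cong (_+ p Cℚ t * E0 d) (trans (∑-cong (suc d) λ u _ → factor u) (∑-*ˡ (suc d) (p Cℚ t) λ u → d Cℚ u * E0 u)) ⟩
  p Cℚ t * ∑[ u < suc d ] (d Cℚ u * E0 u) + p Cℚ t * E0 d
    ≡⟨ sym (*-distribˡ-+ (p Cℚ t) _ (E0 d)) ⟩
  p Cℚ t * (∑[ u < suc d ] (d Cℚ u * E0 u) + E0 d)
    ≡⟨ cong (p Cℚ t *_) (EulerPoly-recurrence d 0ℚ) ⟩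
  p Cℚ t * (2ℚ * 0ℚ ^ℚ d)  ∎
  where
  open ≡-Reasoning
  p = t ℕ.+ d
  entry : ℕ → ℚ
  entry n = p Cℚ n * eulerMatrix n t
  factor : ∀ u → entry (t ℕ.+ u) ≡ p Cℚ t * (d Cℚ u * E0 u)
  factor u = begin
    p Cℚ (t ℕ.+ u) * ((t ℕ.+ u) Cℚ t * E0 (t ℕ.+ u ∸ t))
      ≡⟨ sym (*-assoc (p Cℚ (t ℕ.+ u)) _ _) ⟩
    p Cℚ (t ℕ.+ u) * (t ℕ.+ u) Cℚ t * E0 (t ℕ.+ u ∸ t)
      ≡⟨ cong (_* E0 (t ℕ.+ u ∸ t)) (nCℚr*rCℚk≡nCℚk*[n∸k]Cℚ[r∸k] p (ℕ.m≤m+n t u)) ⟩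
    p Cℚ t * (p ∸ t) Cℚ (t ℕ.+ u ∸ t) * E0 (t ℕ.+ u ∸ t)
      ≡⟨ cong₂ (λ k l → p Cℚ t * k Cℚ l * E0 l) (ℕ.m+n∸m≡n t d) (ℕ.m+n∸m≡n t u) ⟩
    p Cℚ t * d Cℚ u * E0 u
      ≡⟨ *-assoc (p Cℚ t) _ _ ⟩
    p Cℚ t * (d Cℚ u * E0 u)  ∎

[P+I]Ê-diagonal : ∀ {N t} → t < N → [P+I]Ê N t t ≡ 2ℚ
[P+I]Ê-diagonal {N} {t} t<N = begin
  [P+I]Ê N t t                         ≡⟨ [P+I]Ê-truncate t t<N ⟩
  [P+I]Ê (suc t) t t                   ≡⟨ cong (λ k → [P+I]Ê (suc k) k t) (sym (ℕ.+-identityʳ t)) ⟩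
  [P+I]Ê (suc (t ℕ.+ 0)) (t ℕ.+ 0) t   ≡⟨ [P+I]Ê-column t 0 ⟩
  ℕ→ℚ ((t ℕ.+ 0) C t) * (2ℚ * 1ℚ)      ≡⟨ cong (λ k → ℕ→ℚ (k C t) * (2ℚ * 1ℚ)) (ℕ.+-identityʳ t) ⟩
  ℕ→ℚ (t C t) * (2ℚ * 1ℚ)              ≡⟨ cong (λ c → ℕ→ℚ c * (2ℚ * 1ℚ)) (nCn≡1 t) ⟩
  1ℚ * (2ℚ * 1ℚ)                       ≡⟨ trans (*-identityˡ (2ℚ * 1ℚ)) (*-identityʳ 2ℚ) ⟩
  2ℚ                                   ∎
  where open ≡-Reasoning

[P+I]Ê-lower : ∀ {N p t} → p < N → p < t → [P+I]Ê N p t ≡ 0ℚ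
[P+I]Ê-lower {N} {p} {t} p<N p<t = begin
  [P+I]Ê N p t        ≡⟨ [P+I]Ê-truncate t p<N ⟩
  [P+I]Ê (suc p) p t  ≡⟨ cong₂ _+_ (∑-zero (suc p) λ n n≤p → trans
                          (cong (p Cℚ n *_) (eulerMatrix-upper (ℕ.<-≤-trans n≤p p<t))) (*-zeroʳ (p Cℚ n)))
                                   (eulerMatrix-upper p<t) ⟩
  0ℚ + 0ℚ             ≡⟨ +-identityʳ 0ℚ ⟩
  0ℚ                  ∎
  where open ≡-Reasoning

[P+I]Ê-upper : ∀ {N} t d → suc (t ℕ.+ d) < N → [P+I]Ê N (suc (t ℕ.+ d)) t ≡ 0ℚ
[P+I]Ê-upper {N} t d p<N = begin
  [P+I]Ê N p t                                ≡⟨ [P+I]Ê-truncate t p<N ⟩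
  [P+I]Ê (suc p) p t                          ≡⟨ cong (λ k → [P+I]Ê (suc k) k t) (sym (ℕ.+-suc t d)) ⟩
  [P+I]Ê (suc (t ℕ.+ suc d)) (t ℕ.+ suc d) t  ≡⟨ [P+I]Ê-column t (suc d) ⟩
  c * (2ℚ * (0ℚ * 0ℚ ^ℚ d))                   ≡⟨ vanish c (0ℚ ^ℚ d) ⟩
  0ℚ                                          ∎
  where
  open ≡-Reasoning
  p = suc (t ℕ.+ d)
  c = (t ℕ.+ suc d) Cℚ t
  vanish : ∀ c z → c * (2ℚ * (0ℚ * z)) ≡ 0ℚ
  vanish = solve-∀ ℚ-ring

[P+I]Ê-offDiagonal : ∀ {N p t} → p < N → p ≢ t → [P+I]Ê N p t ≡ 0ℚ
[P+I]Ê-offDiagonal {N} {p} {t} p<N p≢t = case ℕ.<-cmp p t of λ where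
  (tri< p<t _ _) → [P+I]Ê-lower p<N p<t
  (tri≈ _ p≡t _) → ⊥-elim (p≢t p≡t)
  (tri> _ _ t<p) → let d , t+1+d≡p = ℕ.m≤n⇒∃[o]m+o≡n t<p in
                   subst (λ q → q < N → [P+I]Ê N q t ≡ 0ℚ) t+1+d≡p ([P+I]Ê-upper t d) p<N

∑a[P+I]Ê≡2a : ∀ N (a : ℕ → ℚ) {t} → t < N →
              ∑[ n < N ] ((∑[ p < N ] (a p * p Cℚ n) + a n) * eulerMatrix n t) ≡ 2ℚ * a t
∑a[P+I]Ê≡2a N a {t} t<N = begin
  ∑[ n < N ] ((∑[ p < N ] (a p * p Cℚ n) + a n) * eulerMatrix n t)
    ≡⟨ ∑-cong N (λ n _ → distribute n) ⟩
  ∑[ n < N ] (∑[ p < N ] (a p * entry p n) + a n * eulerMatrix n t)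
    ≡⟨ ∑-+ N (λ n → ∑[ p < N ] (a p * entry p n)) (λ n → a n * eulerMatrix n t) ⟩
  ∑[ n < N ] ∑[ p < N ] (a p * entry p n) + ∑[ n < N ] (a n * eulerMatrix n t)
    ≡⟨ cong (_+ ∑[ n < N ] (a n * eulerMatrix n t)) (trans (∑-swap N N λ n p → a p * entry p n)
                                                           (∑-cong N λ p _ → ∑-*ˡ N (a p) (entry p))) ⟩
  ∑[ p < N ] (a p * ∑ N (entry p)) + ∑[ p < N ] (a p * eulerMatrix p t)
    ≡⟨ sym (∑-+ N (λ p → a p * ∑ N (entry p)) (λ p → a p * eulerMatrix p t)) ⟩
  ∑[ p < N ] (a p * ∑ N (entry p) + a p * eulerMatrix p t)
    ≡⟨ ∑-cong N (λ p _ → sym (*-distribˡ-+ (a p) (∑ N (entry p)) (eulerMatrix p t))) ⟩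
  ∑[ p < N ] (a p * [P+I]Ê N p t)
    ≡⟨ ∑-single t<N (λ p p<N p≢t → trans (cong (a p *_) ([P+I]Ê-offDiagonal p<N p≢t)) (*-zeroʳ (a p))) ⟩
  a t * [P+I]Ê N t t
    ≡⟨ trans (cong (a t *_) ([P+I]Ê-diagonal t<N)) (*-comm (a t) 2ℚ) ⟩
  2ℚ * a t  ∎
  where
  open ≡-Reasoning
  entry : ℕ → ℕ → ℚ
  entry p n = p Cℚ n * eulerMatrix n t
  distribute : ∀ n → (∑[ p < N ] (a p * p Cℚ n) + a n) * eulerMatrix n t
                   ≡ ∑[ p < N ] (a p * entry p n) + a n * eulerMatrix n t
  distribute n = trans (*-distribʳ-+ (eulerMatrix n t) (∑[ p < N ] (a p * p Cℚ n)) (a n))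
    (cong (_+ a n * eulerMatrix n t) (trans (sym (∑-*ʳ N (eulerMatrix n t) λ p → a p * p Cℚ n))
                                            (∑-cong N λ p _ → *-assoc (a p) (p Cℚ n) (eulerMatrix n t))))

-- The row ρ

-- a C (n - m) with true subtraction: it is 0, not a C 0, when n < m.
_C[_-_] : ℕ → ℕ → ℕ → ℕ
a C[ n     - zero  ] = a C n
a C[ zero  - suc m ] = 0
a C[ suc n - suc m ] = a C[ n - m ]

C[-]-pascal : ∀ a n m → suc a C[ n - m ] ≡ a C[ n - m ] ℕ.+ a C[ n - suc m ]
C[-]-pascal a zero    zero    = refl
C[-]-pascal a (suc n) zero    = trans (sym (nCk+nC[k+1]≡[n+1]C[k+1] a n)) (ℕ.+-comm (a C n) (a C suc n))
C[-]-pascal a zero    (suc m) = refl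
C[-]-pascal a (suc n) (suc m) = C[-]-pascal a n m

C[-]-below : ∀ a {n m} → n < m → a C[ n - m ] ≡ 0
C[-]-below a {zero}  {suc m} _         = refl
C[-]-below a {suc n} {suc m} (s≤s n<m) = C[-]-below a n<m

C[-]-offset : ∀ a m q → a C[ m ℕ.+ q - m ] ≡ a C q
C[-]-offset a zero    q = refl
C[-]-offset a (suc m) q = C[-]-offset a m q

C[n-n]≡1 : ∀ a n → a C[ n - n ] ≡ 1
C[n-n]≡1 a zero    = refl
C[n-n]≡1 a (suc n) = C[n-n]≡1 a n

sign-+ : ∀ m n → sign (m ℕ.+ n) ≡ sign m * sign n
sign-+ zero    n = sym (*-identityˡ (sign n))
sign-+ (suc m) n = trans (cong -_ (sign-+ m n)) (neg-distribˡ-* (sign m) (sign n))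

sign*sign≡1 : ∀ n → sign n * sign n ≡ 1ℚ
sign*sign≡1 zero    = *-identityˡ 1ℚ
sign*sign≡1 (suc n) = trans (-x*-y≡x*y (sign n) (sign n)) (sign*sign≡1 n)
  where
  -x*-y≡x*y : ∀ x y → (- x) * (- y) ≡ x * y
  -x*-y≡x*y = solve-∀ ℚ-ring

x+sign*x≡[isEven]2x : ∀ n x → x + sign n * x ≡ (if isEven n then 2ℚ * x else 0ℚ)
x+sign*x≡[isEven]2x zero          x = x+1*x≡2*x x
  where
  x+1*x≡2*x : ∀ x → x + 1ℚ * x ≡ 2ℚ * x
  x+1*x≡2*x = solve-∀ ℚ-ring
x+sign*x≡[isEven]2x (suc zero)    x = x+-1*x≡0 x
  where
  x+-1*x≡0 : ∀ x → x + (- 1ℚ) * x ≡ 0ℚ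
  x+-1*x≡0 = solve-∀ ℚ-ring
x+sign*x≡[isEven]2x (suc (suc n)) x = trans (cong (λ s → x + s * x) (neg-involutive (sign n)))
                                            (x+sign*x≡[isEven]2x n x)
  where
  neg-involutive : ∀ s → - (- s) ≡ s
  neg-involutive = solve-∀ ℚ-ring

∑-pascal : ∀ m (h : ℕ → ℚ) →
           ∑[ q < suc (suc m) ] (suc m Cℚ q * h q) ≡ ∑[ q < suc m ] (m Cℚ q * (h q + h (suc q)))
∑-pascal m h = begin
  1ℚ * h 0 + ∑[ q < suc m ] (suc m Cℚ suc q * h (suc q))
    ≡⟨ cong (1ℚ * h 0 +_) (∑-cong (suc m) λ q _ → pascal q) ⟩
  1ℚ * h 0 + ∑[ q < suc m ] (m Cℚ q * h (suc q) + m Cℚ suc q * h (suc q))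
    ≡⟨ cong (1ℚ * h 0 +_) (trans (∑-+ (suc m) (λ q → m Cℚ q * h (suc q)) (λ q → m Cℚ suc q * h (suc q)))
                                  (cong (A +_) (∑-last m λ q → m Cℚ suc q * h (suc q)))) ⟩
  1ℚ * h 0 + (A + (B + m Cℚ suc m * h (suc m)))
    ≡⟨ cong (λ c → 1ℚ * h 0 + (A + (B + c * h (suc m)))) (k>n⇒nCℚk≡0 (ℕ.n<1+n m)) ⟩
  1ℚ * h 0 + (A + (B + 0ℚ * h (suc m)))
    ≡⟨ regroup (h 0) A B (h (suc m)) ⟩
  (1ℚ * h 0 + B) + A
    ≡⟨ sym (∑-+ (suc m) (λ q → m Cℚ q * h q) (λ q → m Cℚ q * h (suc q))) ⟩
  ∑[ q < suc m ] (m Cℚ q * h q + m Cℚ q * h (suc q))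
    ≡⟨ ∑-cong (suc m) (λ q _ → sym (*-distribˡ-+ (m Cℚ q) (h q) (h (suc q)))) ⟩
  ∑[ q < suc m ] (m Cℚ q * (h q + h (suc q)))  ∎
  where
  open ≡-Reasoning
  A = ∑[ q < suc m ] (m Cℚ q * h (suc q))
  B = ∑[ q < m ] (m Cℚ suc q * h (suc q))
  pascal : ∀ q → suc m Cℚ suc q * h (suc q) ≡ m Cℚ q * h (suc q) + m Cℚ suc q * h (suc q)
  pascal q = trans (cong (λ c → ℕ→ℚ c * h (suc q)) (sym (nCk+nC[k+1]≡[n+1]C[k+1] m q)))
                   (trans (cong (_* h (suc q)) (ℕ→ℚ-homo-+ (m C q) (m C suc q)))
                          (*-distribʳ-+ (h (suc q)) (m Cℚ q) (m Cℚ suc q)))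
  regroup : ∀ x a b y → 1ℚ * x + (a + (b + 0ℚ * y)) ≡ (1ℚ * x + b) + a
  regroup = solve-∀ ℚ-ring

∑-alternating-C : ∀ m a n →
                  ∑[ q < suc m ] (m Cℚ q * (sign q * (a ℕ.+ q) Cℚ n)) ≡ sign m * ℕ→ℚ (a C[ n - m ])
∑-alternating-C zero    a n = begin
  1ℚ * (1ℚ * (a ℕ.+ 0) Cℚ n) + 0ℚ   ≡⟨ cong (λ k → 1ℚ * (1ℚ * k Cℚ n) + 0ℚ) (ℕ.+-identityʳ a) ⟩
  1ℚ * (1ℚ * a Cℚ n) + 0ℚ           ≡⟨ simplify (a Cℚ n) ⟩
  1ℚ * a Cℚ n                       ∎
  where
  open ≡-Reasoning
  simplify : ∀ x → 1ℚ * (1ℚ * x) + 0ℚ ≡ 1ℚ * x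
  simplify = solve-∀ ℚ-ring
∑-alternating-C (suc m) a n = begin
  ∑[ q < suc (suc m) ] (suc m Cℚ q * h a q)
    ≡⟨ ∑-pascal m (h a) ⟩
  ∑[ q < suc m ] (m Cℚ q * (h a q + h a (suc q)))
    ≡⟨ ∑-cong (suc m) (λ q _ → split q) ⟩
  ∑[ q < suc m ] (m Cℚ q * h a q + - 1ℚ * (m Cℚ q * h (suc a) q))
    ≡⟨ trans (∑-+ (suc m) (λ q → m Cℚ q * h a q) (λ q → - 1ℚ * (m Cℚ q * h (suc a) q)))
             (cong (∑[ q < suc m ] (m Cℚ q * h a q) +_) (∑-*ˡ (suc m) (- 1ℚ) λ q → m Cℚ q * h (suc a) q)) ⟩
  ∑[ q < suc m ] (m Cℚ q * h a q) + - 1ℚ * ∑[ q < suc m ] (m Cℚ q * h (suc a) q)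
    ≡⟨ cong₂ (λ x y → x + - 1ℚ * y) (∑-alternating-C m a n) (∑-alternating-C m (suc a) n) ⟩
  sign m * ℕ→ℚ (a C[ n - m ]) + - 1ℚ * (sign m * ℕ→ℚ (suc a C[ n - m ]))
    ≡⟨ cong (λ c → sign m * ℕ→ℚ (a C[ n - m ]) + - 1ℚ * (sign m * c))
            (trans (cong ℕ→ℚ (C[-]-pascal a n m)) (ℕ→ℚ-homo-+ (a C[ n - m ]) (a C[ n - suc m ]))) ⟩
  sign m * ℕ→ℚ (a C[ n - m ]) + - 1ℚ * (sign m * (ℕ→ℚ (a C[ n - m ]) + ℕ→ℚ (a C[ n - suc m ])))
    ≡⟨ telescope (sign m) (ℕ→ℚ (a C[ n - m ])) (ℕ→ℚ (a C[ n - suc m ])) ⟩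
  (- sign m) * ℕ→ℚ (a C[ n - suc m ])  ∎
  where
  open ≡-Reasoning
  h : ℕ → ℕ → ℚ
  h b q = sign q * (b ℕ.+ q) Cℚ n
  split : ∀ q → m Cℚ q * (h a q + h a (suc q)) ≡ m Cℚ q * h a q + - 1ℚ * (m Cℚ q * h (suc a) q)
  split q = begin
    m Cℚ q * (sign q * (a ℕ.+ q) Cℚ n + (- sign q) * (a ℕ.+ suc q) Cℚ n)
      ≡⟨ cong (λ k → m Cℚ q * (sign q * (a ℕ.+ q) Cℚ n + (- sign q) * k Cℚ n)) (ℕ.+-suc a q) ⟩
    m Cℚ q * (sign q * (a ℕ.+ q) Cℚ n + (- sign q) * (suc a ℕ.+ q) Cℚ n)
      ≡⟨ distribute (m Cℚ q) (sign q) ((a ℕ.+ q) Cℚ n) ((suc a ℕ.+ q) Cℚ n) ⟩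
    m Cℚ q * h a q + - 1ℚ * (m Cℚ q * h (suc a) q)  ∎
    where
    distribute : ∀ c s x y → c * (s * x + (- s) * y) ≡ c * (s * x) + - 1ℚ * (c * (s * y))
    distribute = solve-∀ ℚ-ring
  telescope : ∀ s x y → s * x + - 1ℚ * (s * (x + y)) ≡ (- s) * y
  telescope = solve-∀ ℚ-ring

ρ : ℕ → ℕ → ℚ
ρ m p = sign p * ℕ→ℚ (m C[ p - m ])

ρ-below : ∀ {m p} → p < m → ρ m p ≡ 0ℚ
ρ-below {m} {p} p<m = trans (cong (λ c → sign p * ℕ→ℚ c) (C[-]-below m p<m)) (*-zeroʳ (sign p))

ρ-offset : ∀ m q → ρ m (m ℕ.+ q) ≡ sign (m ℕ.+ q) * m Cℚ q
ρ-offset m q = cong (λ c → sign (m ℕ.+ q) * ℕ→ℚ c) (C[-]-offset m m q)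

∑ρ*C≡C[-] : ∀ m n → ∑[ p < suc (m ℕ.+ m) ] (ρ m p * p Cℚ n) ≡ ℕ→ℚ (m C[ n - m ])
∑ρ*C≡C[-] m n = begin
  ∑ (suc (m ℕ.+ m)) f
    ≡⟨ cong (λ k → ∑ k f) (sym (ℕ.+-suc m m)) ⟩
  ∑ (m ℕ.+ suc m) f
    ≡⟨ ∑-skip m (suc m) (λ p p<m → trans (cong (_* p Cℚ n) (ρ-below p<m)) (*-zeroˡ (p Cℚ n))) ⟩
  ∑[ q < suc m ] f (m ℕ.+ q)
    ≡⟨ ∑-cong (suc m) (λ q _ → shift q) ⟩
  ∑[ q < suc m ] (sign m * (m Cℚ q * (sign q * (m ℕ.+ q) Cℚ n)))
    ≡⟨ ∑-*ˡ (suc m) (sign m) (λ q → m Cℚ q * (sign q * (m ℕ.+ q) Cℚ n)) ⟩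
  sign m * ∑[ q < suc m ] (m Cℚ q * (sign q * (m ℕ.+ q) Cℚ n))
    ≡⟨ cong (sign m *_) (∑-alternating-C m m n) ⟩
  sign m * (sign m * ℕ→ℚ (m C[ n - m ]))
    ≡⟨ sym (*-assoc (sign m) (sign m) _) ⟩
  sign m * sign m * ℕ→ℚ (m C[ n - m ])
    ≡⟨ trans (cong (_* ℕ→ℚ (m C[ n - m ])) (sign*sign≡1 m)) (*-identityˡ _) ⟩
  ℕ→ℚ (m C[ n - m ])  ∎
  where
  open ≡-Reasoning
  f : ℕ → ℚ
  f p = ρ m p * p Cℚ n
  reassoc : ∀ s r c x → s * r * c * x ≡ s * (c * (r * x))
  reassoc = solve-∀ ℚ-ring
  shift : ∀ q → f (m ℕ.+ q) ≡ sign m * (m Cℚ q * (sign q * (m ℕ.+ q) Cℚ n))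
  shift q = begin
    ρ m (m ℕ.+ q) * (m ℕ.+ q) Cℚ n                ≡⟨ cong (_* (m ℕ.+ q) Cℚ n) (ρ-offset m q) ⟩
    sign (m ℕ.+ q) * m Cℚ q * (m ℕ.+ q) Cℚ n      ≡⟨ cong (λ s → s * m Cℚ q * (m ℕ.+ q) Cℚ n) (sign-+ m q) ⟩
    sign m * sign q * m Cℚ q * (m ℕ.+ q) Cℚ n     ≡⟨ reassoc (sign m) (sign q) (m Cℚ q) ((m ℕ.+ q) Cℚ n) ⟩
    sign m * (m Cℚ q * (sign q * (m ℕ.+ q) Cℚ n)) ∎

paritySum : ℕ → ℕ → ℚ
paritySum m t = sumParity m 0 m (λ i → m Cℚ i * eulerMatrix (m ℕ.+ i) t)

∑[C[-]+ρ]Ê≡2*paritySum : ∀ m t →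
  ∑[ n < suc (m ℕ.+ m) ] ((ℕ→ℚ (m C[ n - m ]) + ρ m n) * eulerMatrix n t) ≡ 2ℚ * paritySum m t
∑[C[-]+ρ]Ê≡2*paritySum m t = begin
  ∑ (suc (m ℕ.+ m)) g
    ≡⟨ cong (λ k → ∑ k g) (sym (ℕ.+-suc m m)) ⟩
  ∑ (m ℕ.+ suc m) g
    ≡⟨ ∑-skip m (suc m) below ⟩
  ∑[ i < suc m ] g (m ℕ.+ i)
    ≡⟨ ∑-cong (suc m) (λ i _ → parity i) ⟩
  ∑[ i < suc m ] (2ℚ * even i)
    ≡⟨ ∑-*ˡ (suc m) 2ℚ even ⟩
  2ℚ * ∑ (suc m) even
    ≡⟨ cong (2ℚ *_) (sym (sumFromTo≡∑ 0 m even)) ⟩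
  2ℚ * paritySum m t  ∎
  where
  open ≡-Reasoning
  g : ℕ → ℚ
  g n = (ℕ→ℚ (m C[ n - m ]) + ρ m n) * eulerMatrix n t
  even : ℕ → ℚ
  even i = if isEven (m ℕ.+ i) then m Cℚ i * eulerMatrix (m ℕ.+ i) t else 0ℚ
  below : ∀ n → n < m → g n ≡ 0ℚ
  below n n<m = trans (cong (λ c → (ℕ→ℚ c + sign n * ℕ→ℚ c) * eulerMatrix n t) (C[-]-below m n<m))
                      (vanish (sign n) (eulerMatrix n t))
    where
    vanish : ∀ s e → (0ℚ + s * 0ℚ) * e ≡ 0ℚ
    vanish = solve-∀ ℚ-ring
  if-2x*e : ∀ b x e → (if b then 2ℚ * x else 0ℚ) * e ≡ 2ℚ * (if b then x * e else 0ℚ)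
  if-2x*e true  x e = *-assoc 2ℚ x e
  if-2x*e false x e = trans (*-zeroˡ e) (sym (*-zeroʳ 2ℚ))
  parity : ∀ i → g (m ℕ.+ i) ≡ 2ℚ * even i
  parity i = begin
    (ℕ→ℚ (m C[ m ℕ.+ i - m ]) + ρ m (m ℕ.+ i)) * e
      ≡⟨ cong (λ c → (ℕ→ℚ c + sign (m ℕ.+ i) * ℕ→ℚ c) * e) (C[-]-offset m m i) ⟩
    (m Cℚ i + sign (m ℕ.+ i) * m Cℚ i) * e
      ≡⟨ cong (_* e) (x+sign*x≡[isEven]2x (m ℕ.+ i) (m Cℚ i)) ⟩
    (if isEven (m ℕ.+ i) then 2ℚ * m Cℚ i else 0ℚ) * e
      ≡⟨ if-2x*e (isEven (m ℕ.+ i)) (m Cℚ i) e ⟩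
    2ℚ * even i  ∎
    where e = eulerMatrix (m ℕ.+ i) t

paritySum-closedForm : ∀ m {t} → t ≤ m ℕ.+ m → paritySum m t ≡ ρ m t
paritySum-closedForm m {t} t≤2m = begin
  paritySum m t
    ≡⟨ sym (½*[2*x]≡x (paritySum m t)) ⟩
  ½ * (2ℚ * paritySum m t)
    ≡⟨ cong (½ *_) (sym (∑[C[-]+ρ]Ê≡2*paritySum m t)) ⟩
  ½ * ∑[ n < N ] ((ℕ→ℚ (m C[ n - m ]) + ρ m n) * eulerMatrix n t)
    ≡⟨ cong (½ *_) (∑-cong N λ n _ → cong (λ c → (c + ρ m n) * eulerMatrix n t) (sym (∑ρ*C≡C[-] m n))) ⟩
  ½ * ∑[ n < N ] ((∑[ p < N ] (ρ m p * p Cℚ n) + ρ m n) * eulerMatrix n t)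
    ≡⟨ cong (½ *_) (∑a[P+I]Ê≡2a N (ρ m) (s≤s t≤2m)) ⟩
  ½ * (2ℚ * ρ m t)
    ≡⟨ ½*[2*x]≡x (ρ m t) ⟩
  ρ m t  ∎
  where
  open ≡-Reasoning
  N = suc (m ℕ.+ m)
  ½*[2*x]≡x : ∀ x → ½ * (2ℚ * x) ≡ x
  ½*[2*x]≡x = solve-∀ ℚ-ring

revise-summand : ∀ {N k t r x} c → k ≤ t → r ≡ t ∸ k → x ≡ N ∸ t →
                 c * N Cℚ k * (N ∸ k) Cℚ r * E0 x ≡ t Cℚ k * (c * eulerMatrix N t)
revise-summand {N} {k} {t} c k≤t refl refl = begin
  c * N Cℚ k * (N ∸ k) Cℚ (t ∸ k) * E0 (N ∸ t)
    ≡⟨ reassocˡ c (N Cℚ k) ((N ∸ k) Cℚ (t ∸ k)) (E0 (N ∸ t)) ⟩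
  c * (N Cℚ k * (N ∸ k) Cℚ (t ∸ k)) * E0 (N ∸ t)
    ≡⟨ cong (λ b → c * b * E0 (N ∸ t)) (sym (nCℚr*rCℚk≡nCℚk*[n∸k]Cℚ[r∸k] N k≤t)) ⟩
  c * (N Cℚ t * t Cℚ k) * E0 (N ∸ t)
    ≡⟨ reassocʳ c (N Cℚ t) (t Cℚ k) (E0 (N ∸ t)) ⟩
  t Cℚ k * (c * (N Cℚ t * E0 (N ∸ t)))  ∎
  where
  open ≡-Reasoning
  reassocˡ : ∀ c a b e → c * a * b * e ≡ c * (a * b) * e
  reassocˡ = solve-∀ ℚ-ring
  reassocʳ : ∀ c a b e → c * (a * b) * e ≡ b * (c * (a * e))
  reassocʳ = solve-∀ ℚ-ring

theorem1p13-1 : ∀ m k → k ≤ m →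
  sumParity m 0 m (λ i → ℕ→ℚ (m C i) * ℕ→ℚ ((m ℕ.+ i) C k) * ℕ→ℚ ((m ℕ.+ i ∸ k) C (m ∸ k)) * EulerPoly i 0ℚ)
    ≡ sign m * ℕ→ℚ (m C k)
theorem1p13-1 m k k≤m = begin
  sumParity m 0 m _
    ≡⟨ sumParity-scale m 0 m (m Cℚ k) (λ i → revise-summand (m Cℚ i) k≤m refl (sym (ℕ.m+n∸m≡n m i))) ⟩
  m Cℚ k * paritySum m m
    ≡⟨ cong (m Cℚ k *_) (paritySum-closedForm m (ℕ.m≤m+n m m)) ⟩
  m Cℚ k * (sign m * ℕ→ℚ (m C[ m - m ]))
    ≡⟨ cong (λ c → m Cℚ k * (sign m * ℕ→ℚ c)) (C[n-n]≡1 m m) ⟩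
  m Cℚ k * (sign m * 1ℚ)
    ≡⟨ trans (cong (m Cℚ k *_) (*-identityʳ (sign m))) (*-comm (m Cℚ k) (sign m)) ⟩
  sign m * m Cℚ k  ∎
  where open ≡-Reasoning

theorem1p13-2 : ∀ m k → k < m →
  sumParity m 0 m (λ i → ℕ→ℚ (m C i) * ℕ→ℚ ((m ℕ.+ i) C k) * ℕ→ℚ ((m ℕ.+ i ∸ k) C (m ∸ k ∸ 1)) * EulerPoly (i ℕ.+ 1) 0ℚ)
    ≡ 0ℚ
theorem1p13-2 (suc m) k (s≤s k≤m) = begin
  sumParity (suc m) 0 (suc m) _
    ≡⟨ sumParity-scale (suc m) 0 (suc m) (m Cℚ k) (λ i → revise-summand (suc m Cℚ i) k≤m r≡ (x≡ i)) ⟩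
  m Cℚ k * paritySum (suc m) m
    ≡⟨ cong (m Cℚ k *_) (paritySum-closedForm (suc m) (ℕ.≤-trans (ℕ.n≤1+n m) (ℕ.m≤m+n (suc m) (suc m)))) ⟩
  m Cℚ k * ρ (suc m) m
    ≡⟨ trans (cong (m Cℚ k *_) (ρ-below (ℕ.n<1+n m))) (*-zeroʳ (m Cℚ k)) ⟩
  0ℚ  ∎
  where
  open ≡-Reasoning
  r≡ : suc m ∸ k ∸ 1 ≡ m ∸ k
  r≡ = trans (ℕ.∸-+-assoc (suc m) k 1) (cong (suc m ∸_) (ℕ.+-comm k 1))
  x≡ : ∀ i → i ℕ.+ 1 ≡ suc m ℕ.+ i ∸ m
  x≡ i = sym (trans (cong (_∸ m) (sym (ℕ.+-suc m i))) (trans (ℕ.m+n∸m≡n m (suc i)) (ℕ.+-comm 1 i)))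

theorem1p13-3 : ∀ m k l → l ℕ.+ k < m →
  sumParity m 0 m (λ i → ℕ→ℚ (m C i) * ℕ→ℚ ((m ℕ.+ i) C k) * ℕ→ℚ ((m ℕ.+ i ∸ k) C l) * EulerPoly (m ℕ.+ i ∸ k ∸ l) 0ℚ)
    ≡ 0ℚ
theorem1p13-3 m k l t<m = begin
  sumParity m 0 m _
    ≡⟨ sumParity-scale m 0 m (t Cℚ k) (λ i → revise-summand (m Cℚ i) (ℕ.m≤n+m k l) (sym (ℕ.m+n∸n≡m l k)) (x≡ i)) ⟩
  t Cℚ k * paritySum m t
    ≡⟨ cong (t Cℚ k *_) (paritySum-closedForm m (ℕ.≤-trans (ℕ.<⇒≤ t<m) (ℕ.m≤m+n m m))) ⟩
  t Cℚ k * ρ m t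
    ≡⟨ trans (cong (t Cℚ k *_) (ρ-below t<m)) (*-zeroʳ (t Cℚ k)) ⟩
  0ℚ  ∎
  where
  open ≡-Reasoning
  t = l ℕ.+ k
  x≡ : ∀ i → m ℕ.+ i ∸ k ∸ l ≡ m ℕ.+ i ∸ t
  x≡ i = trans (ℕ.∸-+-assoc (m ℕ.+ i) k l) (cong (m ℕ.+ i ∸_) (ℕ.+-comm k l))

theorem1p13-4 : ∀ m k j → j ≤ m → k ≤ m →
  sumParity m j m (λ i → ℕ→ℚ (m C i) * ℕ→ℚ ((m ℕ.+ i) C k) * ℕ→ℚ ((m ℕ.+ i ∸ k) C (m ℕ.+ j ∸ k)) * EulerPoly (i ∸ j) 0ℚ)
    ≡ sign (m ℕ.+ j) * ℕ→ℚ (m C j) * ℕ→ℚ ((m ℕ.+ j) C k)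
theorem1p13-4 m k j j≤m k≤m = begin
  sumParity m j m _
    ≡⟨ sumParity-scale m j m (t Cℚ k) (λ i → revise-summand (m Cℚ i) (ℕ.≤-trans k≤m (ℕ.m≤m+n m j)) refl (x≡ i)) ⟩
  t Cℚ k * sumParity m j m g
    ≡⟨ cong (t Cℚ k *_) (sumFromTo-skip (ℕ.m≤n⇒m≤1+n j≤m) λ i i<j → g≡0 i (ℕ.+-monoʳ-< m i<j)) ⟩
  t Cℚ k * paritySum m t
    ≡⟨ cong (t Cℚ k *_) (paritySum-closedForm m (ℕ.+-monoʳ-≤ m j≤m)) ⟩
  t Cℚ k * ρ m t
    ≡⟨ cong (t Cℚ k *_) (ρ-offset m j) ⟩
  t Cℚ k * (sign t * m Cℚ j)
    ≡⟨ *-comm (t Cℚ k) (sign t * m Cℚ j) ⟩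
  sign t * m Cℚ j * t Cℚ k  ∎
  where
  open ≡-Reasoning
  t = m ℕ.+ j
  g : ℕ → ℚ
  g i = m Cℚ i * eulerMatrix (m ℕ.+ i) t
  x≡ : ∀ i → i ∸ j ≡ m ℕ.+ i ∸ t
  x≡ i = sym (ℕ.[m+n]∸[m+o]≡n∸o m i j)
  g≡0 : ∀ i → m ℕ.+ i < t → (if isEven (m ℕ.+ i) then g i else 0ℚ) ≡ 0ℚ
  g≡0 i m+i<t with isEven (m ℕ.+ i)
  ... | true  = trans (cong (m Cℚ i *_) (eulerMatrix-upper m+i<t)) (*-zeroʳ (m Cℚ i))
  ... | false = refl

theorem1p13 : (m k : ℕ) →
    (k ≤ m →
    sumParity m 0 m (λ i → ℕ→ℚ (m C i) * ℕ→ℚ ((m ℕ.+ i) C k) * ℕ→ℚ ((m ℕ.+ i ∸ k) C (m ∸ k)) * EulerPoly i 0ℚ)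
    ≡ sign m * ℕ→ℚ (m C k))
    × (k < m →
    sumParity m 0 m (λ i → ℕ→ℚ (m C i) * ℕ→ℚ ((m ℕ.+ i) C k) * ℕ→ℚ ((m ℕ.+ i ∸ k) C (m ∸ k ∸ 1)) * EulerPoly (i ℕ.+ 1) 0ℚ)
    ≡ 0ℚ)
    × ((l : ℕ) → l ℕ.+ k < m →
    sumParity m 0 m (λ i → ℕ→ℚ (m C i) * ℕ→ℚ ((m ℕ.+ i) C k) * ℕ→ℚ ((m ℕ.+ i ∸ k) C l) * EulerPoly (m ℕ.+ i ∸ k ∸ l) 0ℚ)
    ≡ 0ℚ)
    × ((j : ℕ) → 1 ≤ j → j ≤ m → k ≤ m →
    sumParity m j m (λ i → ℕ→ℚ (m C i) * ℕ→ℚ ((m ℕ.+ i) C k) * ℕ→ℚ ((m ℕ.+ i ∸ k) C (m ℕ.+ j ∸ k)) * EulerPoly (i ∸ j) 0ℚ)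
    ≡ sign (m ℕ.+ j) * ℕ→ℚ (m C j) * ℕ→ℚ ((m ℕ.+ j) C k))
-- (4) also holds for j = 0, where it is (1).
theorem1p13 m k = theorem1p13-1 m k , theorem1p13-2 m k , theorem1p13-3 m k , λ j _ → theorem1p13-4 m k j
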